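{- Let $S=\{x_1,\dots,x_n\}\subseteq\Pi^d$, let $x^*$ be an optimal Ulam 1-median of $S$, $OPT=\sum_i\Delta(x_i,x^*)$, and assume $\Delta(x_1,x^*)\le\dots\le\Delta(x_n,x^*)$. Let $\alpha\in(0,1/3]$ be a constant, let $t$ be the least index with $\Delta(x_t,x^*)>(1+\alpha)\frac{OPT}{n}$, let $F=\{x_t,\dots,x_n\}$, and let $OPT_F=\sum_{x\in F}\Delta(x,x^*)$. Let $c_2\in(0,1/3]$ be any constant. If $OPT_F\ge c_2\cdot OPT$, then a point $x$ chosen uniformly at random from $\{x_1,\dots,x_n\}$ satisfies $\mathrm{Obj}(S,x)\le\left(2-\left(\frac{3\alpha c_2}{8}\right)^2\right)OPT$ with probability at least $\frac{\alpha}{2+\alpha}\cdot\left(1-\frac{1}{1+\frac{3\alpha c_2}{16}}\right)$.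
   Context: $\Pi^d$ is the set of permutations of $[d]$; $\Delta(x,y)=d-\mathrm{lcs}(x,y)$ is the Ulam distance, with $\mathrm{lcs}$ the length of a longest common subsequence; $\mathrm{Obj}(S,x)=\sum_{s\in S}\Delta(s,x)$; an optimal 1-median $x^*$ minimizes $\mathrm{Obj}(S,\cdot)$ over $\Pi^d$.
   Formalization: The constants α and c₂ are taken to be rational numbers in (0,1/3]. -}

module Defs where

open import Data.Nat as ℕ using (ℕ; zero; suc)
open import Data.Fin as Fin using (Fin; toℕ)
open import Data.Fin.Permutation using (Permutation′; _⟨$⟩ʳ_)
open import Data.List as List using (List; []; _∷_; _++_; map; length; filter; allFin; foldr)
import Data.List.Relation.Binary.Sublist.DecPropositional as DecSub
open import Data.Integer using (+_)
open import Data.Nat.ListAction using (sum)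
open import Data.Rational as ℚ using (ℚ; Positive; _/_; 1/_; _÷_; _*_; _+_; _-_)
open import Data.Rational.Properties using (pos⇒nonZero; pos+pos⇒pos; pos*pos⇒pos)

Perm : ℕ → Set
Perm d = Permutation′ d

seq : ∀ {d} → Perm d → List (Fin d)
seq {d} π = map (π ⟨$⟩ʳ_) (allFin d)

subsequences : ∀ {A : Set} → List A → List (List A)
subsequences []       = [] ∷ []
subsequences (x ∷ xs) = map (x ∷_) (subsequences xs) ++ subsequences xs

maximum : List ℕ → ℕ
maximum = foldr ℕ._⊔_ 0

lcs : ∀ {d} → List (Fin d) → List (Fin d) → ℕ
lcs {d} xs ys = maximum (map length (filter (λ zs → zs ⊆? ys) (subsequences xs)))
  where open DecSub {A = Fin d} Fin._≟_ using (_⊆?_)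

Δ : ∀ {d} → Perm d → Perm d → ℕ
Δ {d} x y = d ℕ.∸ lcs (seq x) (seq y)

Σ : ∀ {n} → (Fin n → ℕ) → ℕ
Σ {n} f = sum (map f (allFin n))

Obj : ∀ {n d} → (Fin n → Perm d) → Perm d → ℕ
Obj S x = Σ (λ i → Δ (S i) x)

IsOptimalMedian : ∀ {n d} → (Fin n → Perm d) → Perm d → Set
IsOptimalMedian {d = d} S x* = ∀ (y : Perm d) → Obj S x* ℕ.≤ Obj S y

ℕ→ℚ : ℕ → ℚ
ℕ→ℚ k = + k / 1

probBound : (α c₂ : ℚ) → .{{Positive α}} → .{{Positive c₂}} → ℚ
probBound α c₂ =
  (_÷_ α ((+ 2 / 1) + α) {{pos⇒nonZero ((+ 2 / 1) + α) {{pos+pos⇒pos (+ 2 / 1) α}}}})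
  * (ℚ.1ℚ - 1/_ (ℚ.1ℚ + b) {{pos⇒nonZero (ℚ.1ℚ + b) {{pos+pos⇒pos ℚ.1ℚ b {{bpos}}}}}})
  where
  b : ℚ
  b = (+ 3 / 16) * α * c₂
  bpos : Positive b
  bpos = pos*pos⇒pos ((+ 3 / 16) * α) {{pos*pos⇒pos (+ 3 / 16) α}} c₂

-- By the triangle inequality, Obj(S, xᵢ) ≤ OPT + n·Δ(xᵢ, x*). With γ = (3αc₂/8)², call xᵢ good if
-- Obj(S, xᵢ) ≤ (2 − γ)·OPT. Every point satisfies
--   (1 − γ)·OPT + (α/2)·n·Δ(xᵢ, x*)·[xᵢ ∈ F] ≤ n·Δ(xᵢ, x*) + OPT·[xᵢ good]:
-- a far point has n·Δ(xᵢ, x*) ≥ (1 + α)·OPT and pays for itself, a near bad point has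
-- n·Δ(xᵢ, x*) > (1 − γ)·OPT. Summing over i and using OPT_F ≥ c₂·OPT gives
-- #good ≥ n·(αc₂/2 − γ) ≥ n·3αc₂/16, which dominates the stated probability (if OPT = 0 every
-- point is good). The triangle inequality for Δ holds because two subsequences of z of lengths
-- a and b share a subsequence of length at least a + b − |z|.
module Submission where

open import Defs

module UlamDistance where

  open import Data.Nat using (ℕ; suc; _+_; _∸_; _≤_; z≤n; s≤s)
  open import Data.Nat.Properties
  open import Data.Nat.Solver using (module +-*-Solver)
  open import Data.Fin as Fin using (Fin)
  open import Data.List using ([]; _∷_; map; length; filter; allFin)
  open import Data.List.Properties using (length-map; length-tabulate)
  open import Data.List.Membership.Propositional using (_∈_)
  open import Data.List.Relation.Unary.Any using (here; there)
  open import Data.List.Membership.Propositional.Properties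
    using (∈-filter⁺; ∈-filter⁻; ∈-++⁺ˡ; ∈-++⁺ʳ; ∈-++⁻; ∈-map⁺; ∈-map⁻)
  import Data.List.Relation.Binary.Sublist.Propositional as Sublist
  open import Data.List.Relation.Binary.Sublist.Propositional.Properties using (length-mono-≤)
  import Data.List.Relation.Binary.Sublist.DecPropositional as DecSublist
  open import Data.Product using (∃; _×_; _,_)
  open import Data.Sum using (_⊎_; inj₁; inj₂)
  open import Relation.Binary.PropositionalEquality using (_≡_; refl; sym; trans; cong; cong₂)

  suc-+-mono-≤ : ∀ {a c x} → a ≤ c + x → suc a ≤ c + suc x
  suc-+-mono-≤ {c = c} {x} le = ≤-trans (s≤s le) (≤-reflexive (sym (+-suc c x)))

  +-suc-mono-≤ : ∀ {a b c x} → a + b ≤ c + x → a + suc b ≤ c + suc x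
  +-suc-mono-≤ {a} {b} le = ≤-trans (≤-reflexive (+-suc a b)) (suc-+-mono-≤ le)

  module _ {A : Set} where
    open Sublist {A = A} using (_⊆_; []; _∷_; _∷ʳ_)

    ⊆-overlap : ∀ {as bs xs} → as ⊆ xs → bs ⊆ xs →
                ∃ λ cs → cs ⊆ as × cs ⊆ bs × length as + length bs ≤ length cs + length xs
    ⊆-overlap [] [] = [] , [] , [] , z≤n
    ⊆-overlap (x ∷ʳ p) (.x ∷ʳ q) with ⊆-overlap p q
    ... | cs , cs⊆as , cs⊆bs , le = cs , cs⊆as , cs⊆bs , ≤-trans le (+-monoʳ-≤ (length cs) (n≤1+n _))
    ⊆-overlap {bs = b ∷ _} (_ ∷ʳ p) (refl ∷ q) with ⊆-overlap p q
    ... | cs , cs⊆as , cs⊆bs , le = cs , cs⊆as , b ∷ʳ cs⊆bs , +-suc-mono-≤ le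
    ⊆-overlap {a ∷ _} (refl ∷ p) (_ ∷ʳ q) with ⊆-overlap p q
    ... | cs , cs⊆as , cs⊆bs , le = cs , a ∷ʳ cs⊆as , cs⊆bs , suc-+-mono-≤ le
    ⊆-overlap {a ∷ _} (refl ∷ p) (refl ∷ q) with ⊆-overlap p q
    ... | cs , cs⊆as , cs⊆bs , le = a ∷ cs , refl ∷ cs⊆as , refl ∷ cs⊆bs , s≤s (+-suc-mono-≤ le)

    ∈-subsequences⁺ : ∀ {zs xs} → zs ⊆ xs → zs ∈ subsequences xs
    ∈-subsequences⁺ [] = here refl
    ∈-subsequences⁺ {xs = x ∷ xs} (_ ∷ʳ p) = ∈-++⁺ʳ (map (x ∷_) (subsequences xs)) (∈-subsequences⁺ p)
    ∈-subsequences⁺ {xs = x ∷ xs} (refl ∷ p) = ∈-++⁺ˡ (∈-map⁺ (x ∷_) (∈-subsequences⁺ p))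

    ∈-subsequences⁻ : ∀ {zs} xs → zs ∈ subsequences xs → zs ⊆ xs
    ∈-subsequences⁻ [] (here refl) = []
    ∈-subsequences⁻ (x ∷ xs) zs∈ with ∈-++⁻ (map (x ∷_) (subsequences xs)) zs∈
    ... | inj₂ zs∈′ = x ∷ʳ ∈-subsequences⁻ xs zs∈′
    ... | inj₁ x∷ws∈ with ∈-map⁻ (x ∷_) x∷ws∈
    ... | ws , ws∈ , refl = refl ∷ ∈-subsequences⁻ xs ws∈

  ∈⇒≤maximum : ∀ {n ns} → n ∈ ns → n ≤ maximum ns
  ∈⇒≤maximum {ns = m ∷ ms} (here refl) = m≤m⊔n m (maximum ms)
  ∈⇒≤maximum {ns = m ∷ ms} (there n∈ms) = ≤-trans (∈⇒≤maximum n∈ms) (m≤n⊔m m (maximum ms))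

  maximum≡0⊎∈ : ∀ ns → maximum ns ≡ 0 ⊎ maximum ns ∈ ns
  maximum≡0⊎∈ [] = inj₁ refl
  maximum≡0⊎∈ (m ∷ ms) with ⊔-sel m (maximum ms)
  ... | inj₁ eq = inj₂ (here eq)
  ... | inj₂ eq rewrite eq with maximum≡0⊎∈ ms
  ...   | inj₁ eq′ = inj₁ eq′
  ...   | inj₂ max∈ = inj₂ (there max∈)

  module _ {d : ℕ} where
    open DecSublist {A = Fin d} Fin._≟_ using (_⊆_; _⊆?_; ⊆-trans; minimum)

    lcs-≥ : ∀ {zs xs ys} → zs ⊆ xs → zs ⊆ ys → length zs ≤ lcs xs ys
    lcs-≥ {ys = ys} zs⊆xs zs⊆ys =
      ∈⇒≤maximum (∈-map⁺ length (∈-filter⁺ (_⊆? ys) (∈-subsequences⁺ zs⊆xs) zs⊆ys))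

    lcs-witness : ∀ xs ys → ∃ λ zs → zs ⊆ xs × zs ⊆ ys × lcs xs ys ≡ length zs
    lcs-witness xs ys with maximum≡0⊎∈ (map length (filter (_⊆? ys) (subsequences xs)))
    ... | inj₁ eq = [] , minimum xs , minimum ys , eq
    ... | inj₂ max∈ with ∈-map⁻ length max∈
    ... | zs , zs∈ , eq with ∈-filter⁻ (_⊆? ys) zs∈
    ... | zs∈subs , zs⊆ys = zs , ∈-subsequences⁻ xs zs∈subs , zs⊆ys , eq

    length-seq : ∀ (x : Perm d) → length (seq x) ≡ d
    length-seq x = trans (length-map _ (allFin d)) (length-tabulate (λ i → i))

    lcs≤length : ∀ xs ys → lcs xs ys ≤ length ys
    lcs≤length xs ys with lcs-witness xs ys
    ... | zs , _ , zs⊆ys , eq = ≤-trans (≤-reflexive eq) (length-mono-≤ zs⊆ys)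

    lcs-triangle : ∀ xs ys zs → lcs xs zs + lcs ys zs ≤ lcs xs ys + length zs
    lcs-triangle xs ys zs with lcs-witness xs zs | lcs-witness ys zs
    ... | as , as⊆xs , as⊆zs , eqa | bs , bs⊆ys , bs⊆zs , eqb with ⊆-overlap as⊆zs bs⊆zs
    ... | cs , cs⊆as , cs⊆bs , le = begin
      lcs xs zs + lcs ys zs        ≡⟨ cong₂ _+_ eqa eqb ⟩
      length as + length bs        ≤⟨ le ⟩
      length cs + length zs        ≤⟨ +-monoˡ-≤ (length zs) (lcs-≥ (⊆-trans cs⊆as as⊆xs) (⊆-trans cs⊆bs bs⊆ys)) ⟩
      lcs xs ys + length zs        ∎
      where open ≤-Reasoning

  ∸-triangle : ∀ {a b c e} → a ≤ e → b ≤ e → a + b ≤ c + e → e ∸ c ≤ (e ∸ a) + (e ∸ b)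
  ∸-triangle {a} {b} {c} {e} a≤e b≤e le = m≤n+o⇒m∸n≤o e c (+-cancelʳ-≤ (a + b) e _ (begin
    e + (a + b)                          ≤⟨ +-monoʳ-≤ e le ⟩
    e + (c + e)                          ≡⟨ cong (λ k → e + (c + k)) (sym (m+[n∸m]≡n b≤e)) ⟩
    e + (c + (b + (e ∸ b)))              ≡⟨ cong (λ k → k + (c + (b + (e ∸ b)))) (sym (m+[n∸m]≡n a≤e)) ⟩
    (a + (e ∸ a)) + (c + (b + (e ∸ b))) ≡⟨ solve 5 (λ a b c x y → (a :+ x) :+ (c :+ (b :+ y)) := (c :+ (x :+ y)) :+ (a :+ b))
                                                   refl a b c (e ∸ a) (e ∸ b) ⟩
    (c + ((e ∸ a) + (e ∸ b))) + (a + b)  ∎))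
    where open ≤-Reasoning
          open +-*-Solver

  Δ-triangle : ∀ {d} (a b c : Perm d) → Δ a b ≤ Δ a c + Δ b c
  Δ-triangle {d} a b c = ∸-triangle
    (≤-trans (lcs≤length (seq a) (seq c)) (≤-reflexive (length-seq c)))
    (≤-trans (lcs≤length (seq b) (seq c)) (≤-reflexive (length-seq c)))
    (≤-trans (lcs-triangle (seq a) (seq b) (seq c)) (≤-reflexive (cong (lcs (seq a) (seq b) +_) (length-seq c))))

open import Data.Nat as ℕ using (ℕ; suc; NonZero)
import Data.Nat.Properties as ℕ
open import Data.Nat.Coprimality using (1-coprimeTo) renaming (sym to coprime-sym)
open import Data.Nat.ListAction using (sum)
open import Data.Fin as Fin using (Fin; toℕ)
import Data.Fin.Properties as Fin
open import Data.Integer as ℤ using (+_)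
import Data.Integer.Properties as ℤ
open import Data.Rational as ℚ
  using (ℚ; mkℚ; 1/_; _+_; _*_; _-_; -_; _/_; toℚᵘ; 0ℚ; 1ℚ; _≤_; _<_; _≤?_; Positive; nonNegative)
open import Data.Rational.Properties
import Data.Rational.Unnormalised as ℚᵘ
import Data.Rational.Unnormalised.Properties as ℚᵘ
open import Data.Rational.Solver using (module +-*-Solver)
open import Data.List using (List; []; _∷_; map; length; filter; allFin)
open import Data.List.Properties using (length-tabulate; filter-all)
open import Data.List.Membership.Propositional using (_∈_)
open import Data.List.Membership.Propositional.Properties using (∈-allFin; ∈-map⁺)
open import Data.List.Relation.Unary.Any using (here; there)
open import Data.List.Relation.Unary.All.Properties using (tabulate⁺)
open import Data.Bool using (Bool; true; false; T; if_then_else_)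
open import Data.Unit using (tt)
open import Relation.Nullary using (Dec; does; yes; no)
open import Relation.Unary using (Pred; Decidable)
open import Relation.Binary.PropositionalEquality

open UlamDistance using (Δ-triangle)

ℕ→ℚ≡mkℚ : ∀ k → ℕ→ℚ k ≡ mkℚ (+ k) 0 (coprime-sym (1-coprimeTo k))
ℕ→ℚ≡mkℚ k = ↥p/↧p≡p (mkℚ (+ k) 0 (coprime-sym (1-coprimeTo k)))

ℕ→ℚ-homo-+ : ∀ a b → ℕ→ℚ (a ℕ.+ b) ≡ ℕ→ℚ a + ℕ→ℚ b
ℕ→ℚ-homo-+ a b rewrite ℕ→ℚ≡mkℚ a | ℕ→ℚ≡mkℚ b =
  cong (_/ 1) (trans (ℤ.pos-+ a b) (sym (cong₂ ℤ._+_ (ℤ.*-identityʳ (+ a)) (ℤ.*-identityʳ (+ b)))))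

/-*-cancel : ∀ k n .{{_ : NonZero n}} → (+ k / n) * ℕ→ℚ n ≡ ℕ→ℚ k
/-*-cancel k (suc m) = toℚᵘ-injective (begin
  toℚᵘ ((+ k / suc m) * ℕ→ℚ (suc m))          ≈⟨ toℚᵘ-homo-* (+ k / suc m) (ℕ→ℚ (suc m)) ⟩
  toℚᵘ (+ k / suc m) ℚᵘ.* toℚᵘ (ℕ→ℚ (suc m))  ≈⟨ ℚᵘ.*-cong (toℚᵘ-fromℚᵘ (ℚᵘ.mkℚᵘ (+ k) m))
                                                            (ℚᵘ.≃-reflexive (cong toℚᵘ (ℕ→ℚ≡mkℚ (suc m)))) ⟩
  ℚᵘ.mkℚᵘ (+ k) m ℚᵘ.* ℚᵘ.mkℚᵘ (+ suc m) 0     ≈⟨ ℚᵘ.*≡* (trans (ℤ.*-identityʳ (+ k ℤ.* + suc m))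
                                                     (cong (λ z → + k ℤ.* + suc z) (sym (ℕ.*-identityʳ m)))) ⟩
  ℚᵘ.mkℚᵘ (+ k) 0                               ≈⟨ ℚᵘ.≃-reflexive (cong toℚᵘ (ℕ→ℚ≡mkℚ k)) ⟨
  toℚᵘ (ℕ→ℚ k)                                  ∎)
  where open ℚᵘ.≃-Reasoning

p+r≡q⇒p≤q : ∀ {p q} r → 0ℚ ≤ r → p + r ≡ q → p ≤ q
p+r≡q⇒p≤q {p} r 0≤r refl = subst (_≤ p + r) (+-identityʳ p) (+-monoʳ-≤ p 0≤r)

nonNeg-+ : ∀ {p q} → 0ℚ ≤ p → 0ℚ ≤ q → 0ℚ ≤ p + q
nonNeg-+ = +-mono-≤

nonNeg-* : ∀ {p q} → 0ℚ ≤ p → 0ℚ ≤ q → 0ℚ ≤ p * q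
nonNeg-* {p} {q} 0≤p 0≤q = nonNegative⁻¹ (p * q) {{nonNeg*nonNeg⇒nonNeg p {{nonNegative 0≤p}} q {{nonNegative 0≤q}}}}

p≤q⇒0≤q-p : ∀ {p q} → p ≤ q → 0ℚ ≤ q - p
p≤q⇒0≤q-p {p} {q} p≤q = subst (_≤ q - p) (+-inverseʳ p) (+-monoˡ-≤ (- p) p≤q)

0≤ℕ→ℚ : ∀ k → 0ℚ ≤ ℕ→ℚ k
0≤ℕ→ℚ k = nonNegative⁻¹ (ℕ→ℚ k) {{normalize-nonNeg k 1}}

ℕ→ℚ-pos : ∀ n .{{_ : NonZero n}} → Positive (ℕ→ℚ n)
ℕ→ℚ-pos (suc m) = normalize-pos (suc m) 1

ℕ→ℚ-mono-≤ : ∀ {a b} → a ℕ.≤ b → ℕ→ℚ a ≤ ℕ→ℚ b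
ℕ→ℚ-mono-≤ {a} {b} a≤b = p+r≡q⇒p≤q (ℕ→ℚ (b ℕ.∸ a)) (0≤ℕ→ℚ (b ℕ.∸ a))
  (trans (sym (ℕ→ℚ-homo-+ a (b ℕ.∸ a))) (cong ℕ→ℚ (ℕ.m+[n∸m]≡n a≤b)))

indicator : ∀ {ℓ} {P : Set ℓ} → Dec P → ℚ
indicator P? = if does P? then 1ℚ else 0ℚ

0≤indicator : ∀ {ℓ} {P : Set ℓ} (P? : Dec P) → 0ℚ ≤ indicator P?
0≤indicator (yes _) = ≤ᵇ⇒≤ tt
0≤indicator (no _)  = ≤-refl

module _ {A : Set} where

  sumℚ : List A → (A → ℚ) → ℚ
  sumℚ []       f = 0ℚ
  sumℚ (x ∷ xs) f = f x + sumℚ xs f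

  sumℚ-mono-≤ : ∀ xs {f g : A → ℚ} → (∀ x → f x ≤ g x) → sumℚ xs f ≤ sumℚ xs g
  sumℚ-mono-≤ []       f≤g = ≤-refl
  sumℚ-mono-≤ (x ∷ xs) f≤g = +-mono-≤ (f≤g x) (sumℚ-mono-≤ xs f≤g)

  sumℚ-distrib-+ : ∀ xs (f g : A → ℚ) → sumℚ xs (λ x → f x + g x) ≡ sumℚ xs f + sumℚ xs g
  sumℚ-distrib-+ []       f g = sym (+-identityʳ 0ℚ)
  sumℚ-distrib-+ (x ∷ xs) f g rewrite sumℚ-distrib-+ xs f g =
    solve 4 (λ a b c e → (a :+ b) :+ (c :+ e) := (a :+ c) :+ (b :+ e)) refl (f x) (g x) (sumℚ xs f) (sumℚ xs g)
    where open +-*-Solver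

  sumℚ-distribˡ-* : ∀ xs c (f : A → ℚ) → sumℚ xs (λ x → c * f x) ≡ c * sumℚ xs f
  sumℚ-distribˡ-* []       c f = sym (*-zeroʳ c)
  sumℚ-distribˡ-* (x ∷ xs) c f rewrite sumℚ-distribˡ-* xs c f = sym (*-distribˡ-+ c (f x) (sumℚ xs f))

  sumℚ-const : ∀ xs c → sumℚ xs (λ _ → c) ≡ ℕ→ℚ (length xs) * c
  sumℚ-const []       c = sym (*-zeroˡ c)
  sumℚ-const (x ∷ xs) c rewrite sumℚ-const xs c | ℕ→ℚ-homo-+ 1 (length xs) =
    solve 2 (λ c k → c :+ k :* c := (con 1ℚ :+ k) :* c) refl c (ℕ→ℚ (length xs))
    where open +-*-Solver

  ℕ→ℚ-sum : ∀ xs (f : A → ℕ) → ℕ→ℚ (sum (map f xs)) ≡ sumℚ xs (λ x → ℕ→ℚ (f x))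
  ℕ→ℚ-sum []       f = refl
  ℕ→ℚ-sum (x ∷ xs) f = trans (ℕ→ℚ-homo-+ (f x) (sum (map f xs))) (cong (λ s → ℕ→ℚ (f x) + s) (ℕ→ℚ-sum xs f))

  ℕ→ℚ-length-filter : ∀ {p} {P : Pred A p} (P? : Decidable P) xs →
                      ℕ→ℚ (length (filter P? xs)) ≡ sumℚ xs (λ x → indicator (P? x))
  ℕ→ℚ-length-filter P? []       = refl
  ℕ→ℚ-length-filter P? (x ∷ xs) with does (P? x)
  ... | true  = trans (ℕ→ℚ-homo-+ 1 (length (filter P? xs))) (cong (λ s → 1ℚ + s) (ℕ→ℚ-length-filter P? xs))
  ... | false = trans (ℕ→ℚ-length-filter P? xs) (sym (+-identityˡ _))

sumℚ-allFin-const : ∀ n c → sumℚ (allFin n) (λ _ → c) ≡ ℕ→ℚ n * c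
sumℚ-allFin-const n c = trans (sumℚ-const (allFin n) c) (cong (λ k → ℕ→ℚ k * c) (length-tabulate {n = n} (λ i → i)))

Obj-triangle : ∀ {n d} (S : Fin n → Perm d) (x y : Perm d) →
               ℕ→ℚ (Obj S y) ≤ ℕ→ℚ (Obj S x) + ℕ→ℚ n * ℕ→ℚ (Δ y x)
Obj-triangle {n} S x y = begin
  ℕ→ℚ (Obj S y)                                           ≡⟨ ℕ→ℚ-sum L (λ j → Δ (S j) y) ⟩
  sumℚ L (λ j → ℕ→ℚ (Δ (S j) y))                          ≤⟨ sumℚ-mono-≤ L (λ j → ≤-trans (ℕ→ℚ-mono-≤ (Δ-triangle (S j) y x))
                                                                                (≤-reflexive (ℕ→ℚ-homo-+ (Δ (S j) x) (Δ y x)))) ⟩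
  sumℚ L (λ j → ℕ→ℚ (Δ (S j) x) + ℕ→ℚ (Δ y x))            ≡⟨ sumℚ-distrib-+ L _ _ ⟩
  sumℚ L (λ j → ℕ→ℚ (Δ (S j) x)) + sumℚ L (λ _ → ℕ→ℚ (Δ y x))
                                                          ≡⟨ cong₂ _+_ (sym (ℕ→ℚ-sum L (λ j → Δ (S j) x))) (sumℚ-allFin-const n (ℕ→ℚ (Δ y x))) ⟩
  ℕ→ℚ (Obj S x) + ℕ→ℚ n * ℕ→ℚ (Δ y x)                     ∎
  where
  open ≤-Reasoning
  L : List (Fin n)
  L = allFin n

above-threshold : ∀ {n} (D : Fin n → ℕ) → (∀ i j → toℕ i ℕ.≤ toℕ j → D i ℕ.≤ D j) →
                  ∀ {q t} → (∀ i → toℕ i ≡ t → q < ℕ→ℚ (D i)) → ∀ i → t ℕ.≤ toℕ i → q ≤ ℕ→ℚ (D i)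
above-threshold {n} D sorted {q} {t} above-at-t i t≤i = ≤-trans (<⇒≤ (above-at-t t′ (Fin.toℕ-fromℕ< t<n))) (ℕ→ℚ-mono-≤ (sorted t′ i t′≤i))
  where
  t<n : t ℕ.< _
  t<n = ℕ.≤-<-trans t≤i (Fin.toℕ<n i)
  t′ : Fin _
  t′ = Fin.fromℕ< t<n
  t′≤i : toℕ t′ ℕ.≤ toℕ i
  t′≤i = subst (ℕ._≤ toℕ i) (sym (Fin.toℕ-fromℕ< t<n)) t≤i

q*[k/n]≤x⇒q*k≤n*x : ∀ {q x} k n .{{_ : NonZero n}} → q * (+ k / n) ≤ x → q * ℕ→ℚ k ≤ ℕ→ℚ n * x
q*[k/n]≤x⇒q*k≤n*x {q} {x} k n q[k/n]≤x = begin
  q * ℕ→ℚ k               ≡⟨ cong (q *_) (/-*-cancel k n) ⟨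
  q * ((+ k / n) * ℕ→ℚ n) ≡⟨ *-assoc q (+ k / n) (ℕ→ℚ n) ⟨
  q * (+ k / n) * ℕ→ℚ n   ≤⟨ *-monoʳ-≤-nonNeg (ℕ→ℚ n) {{nonNegative (0≤ℕ→ℚ n)}} q[k/n]≤x ⟩
  x * ℕ→ℚ n               ≡⟨ *-comm x (ℕ→ℚ n) ⟩
  ℕ→ℚ n * x               ∎
  where open ≤-Reasoning

-- The inequalities below are proved by writing the gap as a manifestly nonnegative term and
-- checking the resulting identity with the ring solver.
far-point-bound : ∀ {α γ o x} → 0ℚ ≤ α → α ≤ 1ℚ → 0ℚ ≤ γ → 0ℚ ≤ o →
                  (1ℚ + α) * o ≤ x → (1ℚ - γ) * o + (+ 1 / 2) * α * x ≤ x
far-point-bound {α} {γ} {o} {x} 0≤α α≤1 0≤γ 0≤o far =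
  p+r≡q⇒p≤q (((1ℚ - α) + (+ 1 / 2) * α) * (x - (1ℚ + α) * o) + (+ 1 / 2) * α * (1ℚ - α) * o + γ * o)
    (nonNeg-+ (nonNeg-+ (nonNeg-* (nonNeg-+ (p≤q⇒0≤q-p α≤1) κ≥0) (p≤q⇒0≤q-p far))
                        (nonNeg-* (nonNeg-* κ≥0 (p≤q⇒0≤q-p α≤1)) 0≤o))
              (nonNeg-* 0≤γ 0≤o))
    (solve 4 (λ α γ o x →
       ((con 1ℚ :- γ) :* o :+ con (+ 1 / 2) :* α :* x)
         :+ (((con 1ℚ :- α) :+ con (+ 1 / 2) :* α) :* (x :- (con 1ℚ :+ α) :* o)
             :+ con (+ 1 / 2) :* α :* (con 1ℚ :- α) :* o :+ γ :* o)
       := x) refl α γ o x)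
  where
  open +-*-Solver
  κ≥0 : 0ℚ ≤ (+ 1 / 2) * α
  κ≥0 = nonNeg-* {+ 1 / 2} (≤ᵇ⇒≤ tt) 0≤α

near-point-bound : ∀ {γ o x e} → 0ℚ ≤ γ → 0ℚ ≤ o → 0ℚ ≤ x → e ≤ o + x →
                   (good? : Dec (e ≤ ((+ 2 / 1) - γ) * o)) → (1ℚ - γ) * o ≤ x + o * indicator good?
near-point-bound {γ} {o} {x} 0≤γ 0≤o 0≤x _ (yes _) =
  p+r≡q⇒p≤q (x + γ * o) (nonNeg-+ 0≤x (nonNeg-* 0≤γ 0≤o))
    (solve 3 (λ γ o x → (con 1ℚ :- γ) :* o :+ (x :+ γ :* o) := x :+ o :* con 1ℚ) refl γ o x)
  where open +-*-Solver
near-point-bound {γ} {o} {x} {e} _ _ _ e≤o+x (no bad) =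
  p+r≡q⇒p≤q ((o + x) - ((+ 2 / 1) - γ) * o) (p≤q⇒0≤q-p (≤-trans (<⇒≤ (≰⇒> bad)) e≤o+x))
    (solve 3 (λ γ o x → (con 1ℚ :- γ) :* o :+ ((o :+ x) :- (con (+ 2 / 1) :- γ) :* o) := x :+ o :* con 0ℚ) refl γ o x)
  where open +-*-Solver

point-bound : ∀ {α γ o x e} (far : Bool) → 0ℚ ≤ α → α ≤ 1ℚ → 0ℚ ≤ γ → 0ℚ ≤ o → 0ℚ ≤ x →
              (T far → (1ℚ + α) * o ≤ x) → e ≤ o + x → (good? : Dec (e ≤ ((+ 2 / 1) - γ) * o)) →
              (1ℚ - γ) * o + (+ 1 / 2) * α * (if far then x else 0ℚ) ≤ x + o * indicator good?
point-bound {α} {γ} {o} {x} true 0≤α α≤1 0≤γ 0≤o _ far-bound _ good? = begin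
  (1ℚ - γ) * o + (+ 1 / 2) * α * x  ≤⟨ far-point-bound 0≤α α≤1 0≤γ 0≤o (far-bound tt) ⟩
  x                                 ≤⟨ p+r≡q⇒p≤q (o * indicator good?) (nonNeg-* 0≤o (0≤indicator good?)) refl ⟩
  x + o * indicator good?           ∎
  where open ≤-Reasoning
point-bound {α} {γ} {o} false _ _ 0≤γ 0≤o 0≤x _ e≤o+x good? = begin
  (1ℚ - γ) * o + (+ 1 / 2) * α * 0ℚ ≡⟨ cong (λ z → (1ℚ - γ) * o + z) (*-zeroʳ ((+ 1 / 2) * α)) ⟩
  (1ℚ - γ) * o + 0ℚ                 ≡⟨ +-identityʳ _ ⟩
  (1ℚ - γ) * o                      ≤⟨ near-point-bound 0≤γ 0≤o 0≤x e≤o+x good? ⟩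
  _                                 ∎
  where open ≤-Reasoning

averaged-bound : ∀ {N o G P κ γ c₂} → .{{_ : Positive o}} → 0ℚ ≤ N → 0ℚ ≤ κ →
                 N * ((1ℚ - γ) * o) + κ * (N * P) ≤ N * o + o * G → c₂ * o ≤ P →
                 N * (κ * c₂ - γ) ≤ G
averaged-bound {N} {o} {G} {P} {κ} {γ} {c₂} 0≤N 0≤κ summed c₂o≤P = *-cancelˡ-≤-pos o (begin
  o * (N * (κ * c₂ - γ))                                     ≤⟨ p+r≡q⇒p≤q (κ * (N * (P - c₂ * o)))
                                                                  (nonNeg-* 0≤κ (nonNeg-* 0≤N (p≤q⇒0≤q-p c₂o≤P))) refl ⟩
  o * (N * (κ * c₂ - γ)) + κ * (N * (P - c₂ * o))            ≡⟨ solve 6 (λ N o P κ γ c₂ →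
       o :* (N :* (κ :* c₂ :- γ)) :+ κ :* (N :* (P :- c₂ :* o))
         := (N :* ((con 1ℚ :- γ) :* o) :+ κ :* (N :* P)) :- N :* o) refl N o P κ γ c₂ ⟩
  (N * ((1ℚ - γ) * o) + κ * (N * P)) - N * o                 ≤⟨ +-monoˡ-≤ (- (N * o)) summed ⟩
  (N * o + o * G) - N * o                                    ≡⟨ solve 3 (λ N o G → (N :* o :+ o :* G) :- N :* o := o :* G) refl N o G ⟩
  o * G                                                      ∎)
  where open ≤-Reasoning
        open +-*-Solver

a*r*[1-s]≤b : ∀ {a r s b} → 0ℚ ≤ r → 0ℚ ≤ s → 0ℚ ≤ b →
              r * ((+ 2 / 1) + a) ≡ 1ℚ → s * (1ℚ + b) ≡ 1ℚ → a * r * (1ℚ - s) ≤ b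
a*r*[1-s]≤b {a} {r} {s} {b} 0≤r 0≤s 0≤b r-inv s-inv = begin
  a * r * (1ℚ - s)  ≤⟨ *-monoʳ-≤-nonNeg (1ℚ - s) {{nonNegative 0≤1-s}} ar≤1 ⟩
  1ℚ * (1ℚ - s)     ≡⟨ *-identityˡ (1ℚ - s) ⟩
  1ℚ - s            ≤⟨ p+r≡q⇒p≤q (b * (1ℚ - s)) (nonNeg-* 0≤b 0≤1-s) (begin-equality
    1ℚ - s + b * (1ℚ - s)             ≡⟨ solve 2 (λ s b → con 1ℚ :- s :+ b :* (con 1ℚ :- s)
                                                   := (con 1ℚ :+ b) :- s :* (con 1ℚ :+ b)) refl s b ⟩
    (1ℚ + b) - s * (1ℚ + b)           ≡⟨ cong (λ z → (1ℚ + b) - z) s-inv ⟩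
    (1ℚ + b) - 1ℚ                     ≡⟨ solve 1 (λ b → (con 1ℚ :+ b) :- con 1ℚ := b) refl b ⟩
    b                                 ∎) ⟩
  b                 ∎
  where
  open ≤-Reasoning
  open +-*-Solver
  ar≤1 : a * r ≤ 1ℚ
  ar≤1 = p+r≡q⇒p≤q ((+ 2 / 1) * r) (nonNeg-* {+ 2 / 1} (≤ᵇ⇒≤ tt) 0≤r)
    (trans (solve 2 (λ a r → a :* r :+ con (+ 2 / 1) :* r := r :* (con (+ 2 / 1) :+ a)) refl a r) r-inv)
  0≤1-s : 0ℚ ≤ 1ℚ - s
  0≤1-s = subst (0ℚ ≤_) (trans (solve 2 (λ s b → s :* b := s :* (con 1ℚ :+ b) :- s) refl s b)
                               (cong (_- s) s-inv))
                (nonNeg-* 0≤s 0≤b)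

probBound≤ : ∀ α c₂ .{{_ : Positive α}} .{{_ : Positive c₂}} → probBound α c₂ ≤ (+ 3 / 16) * α * c₂
probBound≤ α c₂ = a*r*[1-s]≤b {α} {1/_ ((+ 2 / 1) + α) {{2+α≢0}}} {1/_ (1ℚ + b) {{1+b≢0}}} {b}
  (<⇒≤ (positive⁻¹ _ {{1/pos⇒pos ((+ 2 / 1) + α) {{2+α>0}}}}))
  (<⇒≤ (positive⁻¹ _ {{1/pos⇒pos (1ℚ + b) {{1+b>0}}}}))
  (<⇒≤ (positive⁻¹ b {{b>0}}))
  (*-inverseˡ ((+ 2 / 1) + α) {{2+α≢0}})
  (*-inverseˡ (1ℚ + b) {{1+b≢0}})
  where
  b : ℚ
  b = (+ 3 / 16) * α * c₂
  b>0 : Positive b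
  b>0 = pos*pos⇒pos ((+ 3 / 16) * α) {{pos*pos⇒pos (+ 3 / 16) α}} c₂
  2+α>0 : Positive ((+ 2 / 1) + α)
  2+α>0 = pos+pos⇒pos (+ 2 / 1) α
  1+b>0 : Positive (1ℚ + b)
  1+b>0 = pos+pos⇒pos 1ℚ b {{b>0}}
  2+α≢0 : ℚ.NonZero ((+ 2 / 1) + α)
  2+α≢0 = pos⇒nonZero ((+ 2 / 1) + α) {{2+α>0}}
  1+b≢0 : ℚ.NonZero (1ℚ + b)
  1+b≢0 = pos⇒nonZero (1ℚ + b) {{1+b>0}}

αc₂≤1/9 : ∀ {α c₂} → 0ℚ ≤ α → α ≤ + 1 / 3 → c₂ ≤ + 1 / 3 → α * c₂ ≤ + 1 / 9
αc₂≤1/9 {α} 0≤α α≤⅓ c₂≤⅓ =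
  ≤-trans (*-monoˡ-≤-nonNeg α {{nonNegative 0≤α}} c₂≤⅓) (*-monoʳ-≤-nonNeg (+ 1 / 3) α≤⅓)

3αc₂/16≤αc₂/2-γ : ∀ {α c₂} → 0ℚ ≤ α → 0ℚ ≤ c₂ → α ≤ + 1 / 3 → c₂ ≤ + 1 / 3 →
                  (+ 3 / 16) * α * c₂ ≤ (+ 1 / 2) * α * c₂ - ((+ 3 / 8) * α * c₂) * ((+ 3 / 8) * α * c₂)
3αc₂/16≤αc₂/2-γ {α} {c₂} 0≤α 0≤c₂ α≤⅓ c₂≤⅓ =
  p+r≡q⇒p≤q ((α * c₂) * ((+ 9 / 64) * ((+ 1 / 9) - α * c₂) + (+ 19 / 64)))
    (nonNeg-* (nonNeg-* 0≤α 0≤c₂)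
              (nonNeg-+ (nonNeg-* {+ 9 / 64} (≤ᵇ⇒≤ tt) (p≤q⇒0≤q-p (αc₂≤1/9 0≤α α≤⅓ c₂≤⅓))) (≤ᵇ⇒≤ tt)))
    (solve 2 (λ α c →
       con (+ 3 / 16) :* α :* c :+ (α :* c) :* (con (+ 9 / 64) :* (con (+ 1 / 9) :- α :* c) :+ con (+ 19 / 64))
       := con (+ 1 / 2) :* α :* c :- (con (+ 3 / 8) :* α :* c) :* (con (+ 3 / 8) :* α :* c)) refl α c₂)
  where open +-*-Solver

3αc₂/16≤1 : ∀ {α c₂} → 0ℚ ≤ α → α ≤ + 1 / 3 → c₂ ≤ + 1 / 3 → (+ 3 / 16) * α * c₂ ≤ 1ℚ
3αc₂/16≤1 {α} {c₂} 0≤α α≤⅓ c₂≤⅓ = begin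
  (+ 3 / 16) * α * c₂     ≡⟨ *-assoc (+ 3 / 16) α c₂ ⟩
  (+ 3 / 16) * (α * c₂)   ≤⟨ *-monoˡ-≤-nonNeg (+ 3 / 16) (αc₂≤1/9 0≤α α≤⅓ c₂≤⅓) ⟩
  (+ 3 / 16) * (+ 1 / 9)  ≤⟨ ≤ᵇ⇒≤ tt ⟩
  1ℚ                      ∎
  where open ≤-Reasoning

∈⇒≤sum : ∀ {m ms} → m ∈ ms → m ℕ.≤ sum ms
∈⇒≤sum {ms = m ∷ ms} (here refl) = ℕ.m≤m+n m (sum ms)
∈⇒≤sum {ms = m ∷ ms} (there m∈ms) = ℕ.≤-trans (∈⇒≤sum m∈ms) (ℕ.m≤n+m (sum ms) m)

module GoodCandidates
  {n : ℕ} .{{_ : NonZero n}} (D e : Fin n → ℕ) (far : Fin n → Bool) {α γ : ℚ}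
  (0≤α : 0ℚ ≤ α) (α≤1 : α ≤ 1ℚ) (0≤γ : 0ℚ ≤ γ)
  (e≤OPT+nD : ∀ i → ℕ→ℚ (e i) ≤ ℕ→ℚ (Σ D) + ℕ→ℚ n * ℕ→ℚ (D i))
  (far⇒large : ∀ i → T (far i) → (1ℚ + α) * ℕ→ℚ (Σ D) ≤ ℕ→ℚ n * ℕ→ℚ (D i))
  where

  N OPT OPT-far : ℚ
  N = ℕ→ℚ n
  OPT = ℕ→ℚ (Σ D)
  OPT-far = ℕ→ℚ (Σ (λ i → if far i then D i else 0))

  good? : ∀ i → Dec (ℕ→ℚ (e i) ≤ ((+ 2 / 1) - γ) * OPT)
  good? i = ℕ→ℚ (e i) ≤? ((+ 2 / 1) - γ) * OPT

  #good : ℕ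
  #good = length (filter good? (allFin n))

  OPT≡0⇒#good≡n : Σ D ≡ 0 → #good ≡ n
  OPT≡0⇒#good≡n ΣD≡0 = trans (cong length (filter-all good? (tabulate⁺ good))) (length-tabulate (λ i → i))
    where
    D≡0 : ∀ i → D i ≡ 0
    D≡0 i = ℕ.n≤0⇒n≡0 (subst (D i ℕ.≤_) ΣD≡0 (∈⇒≤sum (∈-map⁺ D (∈-allFin i))))
    good : ∀ i → ℕ→ℚ (e i) ≤ ((+ 2 / 1) - γ) * OPT
    good i = begin
      ℕ→ℚ (e i)                ≤⟨ e≤OPT+nD i ⟩
      OPT + N * ℕ→ℚ (D i)      ≡⟨ cong₂ (λ o d → ℕ→ℚ o + N * ℕ→ℚ d) ΣD≡0 (D≡0 i) ⟩
      0ℚ + N * 0ℚ              ≡⟨ trans (+-identityˡ _) (*-zeroʳ N) ⟩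
      0ℚ                       ≡⟨ sym (*-zeroʳ ((+ 2 / 1) - γ)) ⟩
      ((+ 2 / 1) - γ) * 0ℚ     ≡⟨ cong (λ o → ((+ 2 / 1) - γ) * ℕ→ℚ o) (sym ΣD≡0) ⟩
      ((+ 2 / 1) - γ) * OPT    ∎
      where open ≤-Reasoning

  κ : ℚ
  κ = (+ 1 / 2) * α

  far-part : Fin n → ℕ
  far-part i = if far i then D i else 0

  0≤nD : ∀ i → 0ℚ ≤ N * ℕ→ℚ (D i)
  0≤nD i = nonNeg-* (0≤ℕ→ℚ n) (0≤ℕ→ℚ (D i))

  point-bound-at : ∀ i → (1ℚ - γ) * OPT + κ * (N * ℕ→ℚ (far-part i)) ≤ N * ℕ→ℚ (D i) + OPT * indicator (good? i)
  point-bound-at i = by-farness (far i) (far⇒large i)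
    where
    by-farness : (b : Bool) → (T b → (1ℚ + α) * OPT ≤ N * ℕ→ℚ (D i)) →
                 (1ℚ - γ) * OPT + κ * (N * ℕ→ℚ (if b then D i else 0)) ≤ N * ℕ→ℚ (D i) + OPT * indicator (good? i)
    by-farness true  large = point-bound true 0≤α α≤1 0≤γ (0≤ℕ→ℚ (Σ D)) (0≤nD i) large (e≤OPT+nD i) (good? i)
    by-farness false _     =
      subst (λ z → (1ℚ - γ) * OPT + κ * z ≤ N * ℕ→ℚ (D i) + OPT * indicator (good? i)) (sym (*-zeroʳ N))
            (point-bound false 0≤α α≤1 0≤γ (0≤ℕ→ℚ (Σ D)) (0≤nD i) (λ ()) (e≤OPT+nD i) (good? i))

  summed-point-bounds : N * ((1ℚ - γ) * OPT) + κ * (N * OPT-far) ≤ N * OPT + OPT * ℕ→ℚ #good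
  summed-point-bounds = begin
    N * ((1ℚ - γ) * OPT) + κ * (N * OPT-far)
      ≡⟨ cong₂ _+_ (sym (sumℚ-allFin-const n ((1ℚ - γ) * OPT)))
                   (trans (cong (λ s → κ * (N * s)) (ℕ→ℚ-sum L far-part))
                          (trans (cong (κ *_) (sym (sumℚ-distribˡ-* L N _))) (sym (sumℚ-distribˡ-* L κ _)))) ⟩
    sumℚ L (λ _ → (1ℚ - γ) * OPT) + sumℚ L (λ i → κ * (N * ℕ→ℚ (far-part i)))
      ≡⟨ sym (sumℚ-distrib-+ L _ _) ⟩
    sumℚ L (λ i → (1ℚ - γ) * OPT + κ * (N * ℕ→ℚ (far-part i)))
      ≤⟨ sumℚ-mono-≤ L point-bound-at ⟩
    sumℚ L (λ i → N * ℕ→ℚ (D i) + OPT * indicator (good? i))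
      ≡⟨ sumℚ-distrib-+ L _ _ ⟩
    sumℚ L (λ i → N * ℕ→ℚ (D i)) + sumℚ L (λ i → OPT * indicator (good? i))
      ≡⟨ cong₂ _+_ (trans (sumℚ-distribˡ-* L N _) (cong (N *_) (sym (ℕ→ℚ-sum L D))))
                   (trans (sumℚ-distribˡ-* L OPT _) (cong (OPT *_) (sym (ℕ→ℚ-length-filter good? L)))) ⟩
    N * OPT + OPT * ℕ→ℚ #good ∎
    where
    open ≤-Reasoning
    L : List (Fin n)
    L = allFin n

  p*N≤#good : ∀ {c₂ p} → c₂ * OPT ≤ OPT-far → p ≤ 1ℚ → p ≤ κ * c₂ - γ → p * N ≤ ℕ→ℚ #good
  p*N≤#good {c₂} {p} c₂OPT≤OPT-far p≤1 p≤κc₂-γ = by-OPT (Σ D ℕ.≟ 0)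
    where
    open ≤-Reasoning
    by-OPT : Dec (Σ D ≡ 0) → p * N ≤ ℕ→ℚ #good
    by-OPT (yes ΣD≡0) = begin
      p * N             ≤⟨ *-monoʳ-≤-nonNeg N {{nonNegative (0≤ℕ→ℚ n)}} p≤1 ⟩
      1ℚ * N            ≡⟨ *-identityˡ N ⟩
      N                 ≡⟨ cong ℕ→ℚ (sym (OPT≡0⇒#good≡n ΣD≡0)) ⟩
      ℕ→ℚ #good         ∎
    by-OPT (no ΣD≢0) = begin
      p * N             ≤⟨ *-monoʳ-≤-nonNeg N {{nonNegative (0≤ℕ→ℚ n)}} p≤κc₂-γ ⟩
      (κ * c₂ - γ) * N  ≡⟨ *-comm (κ * c₂ - γ) N ⟩
      N * (κ * c₂ - γ)  ≤⟨ averaged-bound {{ℕ→ℚ-pos (Σ D) {{ℕ.≢-nonZero ΣD≢0}}}} (0≤ℕ→ℚ n)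
                             (nonNeg-* {+ 1 / 2} (≤ᵇ⇒≤ tt) 0≤α) summed-point-bounds c₂OPT≤OPT-far ⟩
      ℕ→ℚ #good         ∎

lemma8 : (n d : ℕ) .{{_ : NonZero n}} (S : Fin n → Perm d) (x* : Perm d)
  → IsOptimalMedian S x*
  → (∀ (i j : Fin n) → i Fin.≤ j → Δ (S i) x* ℕ.≤ Δ (S j) x*)
  → (α : ℚ) .{{_ : Positive α}} → α ≤ + 1 / 3
  → (t : ℕ) → t ℕ.≤ n
  → (∀ (i : Fin n) → toℕ i ℕ.< t
       → ℕ→ℚ (Δ (S i) x*) ≤ (1ℚ + α) * (+ (Obj S x*) / n))
  → (∀ (i : Fin n) → toℕ i ≡ t
       → (1ℚ + α) * (+ (Obj S x*) / n) < ℕ→ℚ (Δ (S i) x*))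
  → (c₂ : ℚ) .{{_ : Positive c₂}} → c₂ ≤ + 1 / 3
  → c₂ * ℕ→ℚ (Obj S x*)
      ≤ ℕ→ℚ (Σ (λ i → if t ℕ.≤ᵇ toℕ i then Δ (S i) x* else 0))
  → probBound α c₂
      ≤ + length (filter (λ i → ℕ→ℚ (Obj S (S i))
                                 ≤? ((+ 2 / 1) - ((+ 3 / 8) * α * c₂) * ((+ 3 / 8) * α * c₂))
                                    * ℕ→ℚ (Obj S x*))
                         (allFin n)) / n
lemma8 n d S x* _ sorted α α≤⅓ t _ _ t-far c₂ c₂≤⅓ OPT-far-large =
  *-cancelʳ-≤-pos N {{ℕ→ℚ-pos n}} (begin
    probBound α c₂ * N   ≤⟨ p*N≤#good OPT-far-large (≤-trans pb≤3αc₂/16 (3αc₂/16≤1 0≤α α≤⅓ c₂≤⅓))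
                                                     (≤-trans pb≤3αc₂/16 (3αc₂/16≤αc₂/2-γ 0≤α 0≤c₂ α≤⅓ c₂≤⅓)) ⟩
    ℕ→ℚ #good            ≡⟨ /-*-cancel #good n ⟨
    (+ #good / n) * N    ∎)
  where
  open ≤-Reasoning
  N : ℚ
  N = ℕ→ℚ n
  D : Fin n → ℕ
  D i = Δ (S i) x*
  0≤α : 0ℚ ≤ α
  0≤α = <⇒≤ (positive⁻¹ α)
  0≤c₂ : 0ℚ ≤ c₂
  0≤c₂ = <⇒≤ (positive⁻¹ c₂)
  pb≤3αc₂/16 : probBound α c₂ ≤ (+ 3 / 16) * α * c₂
  pb≤3αc₂/16 = probBound≤ α c₂
  β : ℚ
  β = (+ 3 / 8) * α * c₂
  0≤β : 0ℚ ≤ β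
  0≤β = nonNeg-* (nonNeg-* {+ 3 / 8} (≤ᵇ⇒≤ tt) 0≤α) 0≤c₂
  far⇒large : ∀ i → T (t ℕ.≤ᵇ toℕ i) → (1ℚ + α) * ℕ→ℚ (Σ D) ≤ N * ℕ→ℚ (D i)
  far⇒large i far = q*[k/n]≤x⇒q*k≤n*x {1ℚ + α} (Σ D) n (above-threshold D sorted t-far i (ℕ.≤ᵇ⇒≤ t (toℕ i) far))
  open GoodCandidates D (λ i → Obj S (S i)) (λ i → t ℕ.≤ᵇ toℕ i)
         0≤α (≤-trans α≤⅓ (≤ᵇ⇒≤ tt)) (nonNeg-* 0≤β 0≤β) (λ i → Obj-triangle S x* (S i)) far⇒large
    using (#good; p*N≤#good)
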